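{- Let $1\leqslant k<n$ be integers. If $x$ is a positive real root of $\mathsf{J}_{k,n}$ such that $x=\mathrm{dec}(x)$, then $\deg(s_\beta x)<\deg(x)$.
   Context: Let $\mathbb{Z}\Delta=\{x\in\mathbb{Z}^n: k\mid x_1+\cdots+x_n\}$ with simple roots $\alpha_i=e_{i+1}-e_i$ ($1\leqslant i\leqslant n-1$) and $\beta=e_1+\cdots+e_k$; $\deg(x)=(x_1+\cdots+x_n)/k$ is the coefficient of $\beta$. The Weyl group is generated by $s_i$ (swapping coordinates $i,i+1$) and $s_\beta(x)=(x_1+r,\ldots,x_k+r,x_{k+1},\ldots,x_n)^\top$, $r=x_{k+1}+\cdots+x_n-2\deg(x)$. Real roots are the elements of the Weyl group orbit of $\beta$; positive means non-negative coefficients in the basis $\beta,\alpha_1,\ldots,\alpha_{n-1}$. $\mathrm{dec}(x)$ is the permutation of the entries of $x$ into weakly decreasing order, so $x=\mathrm{dec}(x)$ means $x_1\geqslant\cdots\geqslant x_n$. -}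

module Defs where

open import Data.Nat as ℕ using (ℕ; zero; suc; _<ᵇ_)
open import Data.Nat.Properties using (<⇒<ᵇ)
open import Data.Bool using (Bool; true; false; if_then_else_)
open import Data.Fin using (Fin; toℕ; fromℕ<; _≟_)
import Data.Integer
open import Data.Fin.Properties using ()
open import Data.Integer using (ℤ; +_; _+_; _-_; _*_; -_; 0ℤ; 1ℤ; _/ℕ_)
open import Data.List using (List; []; _∷_)
open import Data.Product using (Σ; ∃; _,_)
open import Relation.Nullary using (does)
open import Relation.Binary.PropositionalEquality using (_≗_)

-- Vectors in ℤ^n, coordinate j : Fin n is coordinate (toℕ j + 1) of the paper.
Vecℤ : ℕ → Set
Vecℤ n = Fin n → ℤ

sumℤ : ∀ {n} → Vecℤ n → ℤ
sumℤ {zero}  _ = 0ℤ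
sumℤ {suc n} f = f Fin.zero + sumℤ (λ j → f (Fin.suc j))


-- [j < k] as a Boolean (0-based index j, i.e. paper index j+1 ≤ k).
inFirst : ∀ {n} → ℕ → Fin n → Bool
inFirst k j = toℕ j <ᵇ k

β : ∀ {n} → ℕ → Vecℤ n
β k j = if inFirst k j then 1ℤ else 0ℤ

-- α_i = e_{i+1} - e_i (paper), here i is 0-based so α_i = e_{(i+1)+1} - e_{i+1}.
-- coordinate j of α_i is [toℕ j = i+1] - [toℕ j = i].
indicator : Bool → ℤ
indicator true  = 1ℤ
indicator false = 0ℤ

α : ∀ {n} → ℕ → Vecℤ n
α i j = indicator (does (toℕ j ℕ.≟ suc i)) - indicator (does (toℕ j ℕ.≟ i))

-- deg(x) = (x_1 + ... + x_n)/k  (exact on ℤΔ; k ≥ 1 assumed in all uses)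
deg : ∀ {n} → ℕ → Vecℤ n → ℤ
deg zero    x = 0ℤ
deg (suc k) x = sumℤ x /ℕ suc k

tailSum : ∀ {n} → ℕ → Vecℤ n → ℤ
tailSum k x = sumℤ (λ j → if inFirst k j then 0ℤ else x j)

sβ : ∀ {n} → ℕ → Vecℤ n → Vecℤ n
sβ k x j = if inFirst k j then x j + r else x j
  where r = tailSum k x - (+ 2) * deg k x

swapFin : ∀ {n} → Fin n → Fin n → Fin n → Fin n
swapFin a b j = if does (j ≟ a) then b else (if does (j ≟ b) then a else j)

-- Generators of the Weyl group: s_i (swap paper coordinates i+1, i+2 for 0-based i
-- with i+2 ≤ n) and s_β.
data Gen (n : ℕ) : Set where
  sα  : (i : ℕ) → suc i ℕ.< n → Gen n
  sβg : Gen n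

open import Data.Nat.Properties using (<-trans; n<1+n)

act : ∀ {n} → ℕ → Gen n → Vecℤ n → Vecℤ n
act k (sα i p) x j = x (swapFin (fromℕ< (<-trans (n<1+n i) p)) (fromℕ< p) j)
act k sβg      x   = sβ k x

actAll : ∀ {n} → ℕ → List (Gen n) → Vecℤ n → Vecℤ n
actAll k []       x = x
actAll k (g ∷ gs) x = act k g (actAll k gs x)

RealRoot : (n k : ℕ) → Vecℤ n → Set
RealRoot n k x = Σ (List (Gen n)) λ ws → actAll k ws (β k) ≗ x

-- Σ_{i=1}^{n-1} c_i α_i, with c indexed by 0-based i < n-1 (entries with i+1 ≥ n ignored).
αComb : ∀ {n} → (Fin n → ℕ) → Vecℤ n
αComb {n} c j = sumℤ {n} (λ i → if suc (toℕ i) <ᵇ n then (+ c i) * α (toℕ i) j else 0ℤ)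

Positive : (n k : ℕ) → Vecℤ n → Set
Positive n k x = Σ ℕ λ d → Σ (Fin n → ℕ) λ c → x ≗ (λ j → (+ d) * β k j + αComb c j)

-- x = dec(x), i.e. x_1 ≥ x_2 ≥ ... ≥ x_n
IsDecreasing : ∀ {n} → Vecℤ n → Set
IsDecreasing {n} x = (i j : Fin n) → toℕ i ℕ.≤ toℕ j → x j Data.Integer.≤ x i

{-# OPTIONS --safe #-}
-- The reflections s_i and s_β preserve the property Σ x = k·d together with
-- (x,x) = Σ x_j² + (2 − k) d² = 2, where d = deg x; β has it, hence so does every
-- real root. If moreover x = dβ + Σ c_i α_i is decreasing, then pairing with x gives
-- Σ x_j² ≤ d·H with H = x_1 + … + x_k, because x·α_i = x_{i+1} − x_i ≤ 0. Writing
-- T = x_{k+1} + … + x_n = dk − H, this turns (x,x) = 2 into d(T − 2d) ≤ −2, so the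
-- shift T − 2d = deg(s_β x) − deg x is negative.
module Submission where

open import Defs
open import Data.Nat as ℕ using (ℕ; zero; suc; _<ᵇ_; z≤n; s≤s)
import Data.Nat.Properties as ℕ
open import Data.Bool using (true; false; if_then_else_)
open import Data.Fin as F using (Fin; toℕ; fromℕ<)
open import Data.Fin.Properties using (toℕ-fromℕ<)
open import Data.Fin.Patterns using (0F)
import Data.Fin.Permutation as Perm
import Data.Fin.Permutation.Components as PC
open import Data.Integer hiding (suc; _≟_; Positive)
open import Data.Integer using () renaming (suc to sucℤ; _<_ to _<ℤ_)
open import Data.Integer.Properties
open import Data.Integer.DivMod using ([n/ℕd]*d≤n; n<s[n/ℕd]*d)
open import Data.Integer.Tactic.RingSolver using (solve-∀)
open import Algebra.Properties.Semiring.Sum +-*-semiring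
  using (sum; sum-cong-≗; sum-replicate-zero; ∑-distrib-+; ∑-comm; *-distribˡ-sum; sum-permute)
open import Data.Product using (Σ; ∃-syntax; _×_; _,_)
open import Data.Sum using (_⊎_; inj₁; inj₂)
open import Data.List using (List; []; _∷_)
open import Relation.Binary.PropositionalEquality
open import Relation.Nullary using (does)
open import Relation.Nullary.Reflects using (ofʸ)
open import Function using (_∘_)

sumℤ≡sum : ∀ {n} (f : Vecℤ n) → sumℤ f ≡ sum f
sumℤ≡sum {zero}  f = refl
sumℤ≡sum {suc n} f = cong (_+_ (f 0F)) (sumℤ≡sum (f ∘ F.suc))

sum-neg : ∀ {n} (f : Vecℤ n) → sum (λ j → - f j) ≡ - sum f
sum-neg {zero}  f = refl
sum-neg {suc n} f =
  trans (cong (_+_ (- f 0F)) (sum-neg (f ∘ F.suc))) (sym (neg-distrib-+ (f 0F) _))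

sum-nonPos : ∀ {n} (f : Vecℤ n) → (∀ j → f j ≤ 0ℤ) → sum f ≤ 0ℤ
sum-nonPos {zero}  f f≤0 = ≤-refl
sum-nonPos {suc n} f f≤0 = +-mono-≤ (f≤0 0F) (sum-nonPos (f ∘ F.suc) (f≤0 ∘ F.suc))

swapFin≗transpose : ∀ {n} (a b : Fin n) → swapFin a b ≗ PC.transpose a b
swapFin≗transpose a b j with does (j F.≟ a)
... | true  = refl
... | false with does (j F.≟ b)
...   | true  = refl
...   | false = refl

sum-swapFin : ∀ {n} (a b : Fin n) (f : Vecℤ n) → sum (f ∘ swapFin a b) ≡ sum f
sum-swapFin a b f =
  trans (sum-cong-≗ (cong f ∘ swapFin≗transpose a b)) (sym (sum-permute f (Perm.transpose a b)))

sum-*-indicator : ∀ {n} (x : Vecℤ n) m (m<n : m ℕ.< n) →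
  sum (λ j → x j * indicator (does (toℕ j ℕ.≟ m))) ≡ x (fromℕ< m<n)
sum-*-indicator {suc n} x zero    _ = begin
  x 0F * 1ℤ + sum (λ j → x (F.suc j) * 0ℤ)
    ≡⟨ cong₂ _+_ (*-identityʳ (x 0F)) (sum-cong-≗ (*-zeroʳ ∘ x ∘ F.suc)) ⟩
  x 0F + sum {n} (λ _ → 0ℤ) ≡⟨ cong (_+_ (x 0F)) (sum-replicate-zero n) ⟩
  x 0F + 0ℤ                 ≡⟨ +-identityʳ (x 0F) ⟩
  x 0F                      ∎
  where open ≡-Reasoning
sum-*-indicator {suc n} x (suc m) (s≤s m<n) = begin
  x 0F * 0ℤ + rest ≡⟨ cong (λ s → s + rest) (*-zeroʳ (x 0F)) ⟩
  0ℤ + rest        ≡⟨ +-identityˡ rest ⟩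
  rest             ≡⟨ sum-*-indicator (x ∘ F.suc) m m<n ⟩
  x (fromℕ< (s≤s m<n)) ∎
  where
  open ≡-Reasoning
  rest = sum (λ j → x (F.suc j) * indicator (does (toℕ j ℕ.≟ m)))

[i*n]/ℕn≡i : ∀ (i : ℤ) k → (i * + suc k) /ℕ suc k ≡ i
[i*n]/ℕn≡i i k = ≤-antisym q≤i i≤q
  where
  q = (i * + suc k) /ℕ suc k
  q≤i : q ≤ i
  q≤i = *-cancelʳ-≤-pos q i (+ suc k) ([n/ℕd]*d≤n (i * + suc k) (suc k))
  i≤q : i ≤ q
  i≤q = ≤-trans (i<j⇒i≤pred[j] i<1+q) (≤-reflexive (pred-suc q))
    where
    i<1+q : i < sucℤ q
    i<1+q = *-cancelʳ-<-nonNeg (+ suc k) (n<s[n/ℕd]*d (i * + suc k) (suc k))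

deg-exact : ∀ {n} k (x : Vecℤ n) {d} → sum x ≡ d * + suc k → deg (suc k) x ≡ d
deg-exact k x {d} Σx = trans (cong (_/ℕ suc k) (trans (sumℤ≡sum x) Σx)) ([i*n]/ℕn≡i d k)

infix 7 _·_
_·_ : ∀ {n} → Vecℤ n → Vecℤ n → ℤ
x · y = sum (λ j → x j * y j)

sum-β : ∀ n k → k ℕ.≤ n → sum {n} (β k) ≡ + k
sum-β zero    zero    z≤n     = refl
sum-β (suc n) zero    z≤n     = trans (+-identityˡ _) (sum-replicate-zero n)
sum-β (suc n) (suc k) (s≤s p) = cong (_+_ 1ℤ) (sum-β n k p)

β·β : ∀ n k → k ℕ.≤ n → β {n} k · β k ≡ + k
β·β n k k≤n = trans (sum-cong-≗ idem) (sum-β n k k≤n)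
  where
  idem : ∀ j → β {n} k j * β k j ≡ β k j
  idem j with inFirst {n} k j
  ... | true  = refl
  ... | false = refl

·β+tailSum : ∀ {n} k (x : Vecℤ n) → x · β k + tailSum k x ≡ sum x
·β+tailSum {n} k x = begin
  x · β k + tailSum k x              ≡⟨ cong (_+_ (x · β k)) (sumℤ≡sum tail) ⟩
  sum (λ j → x j * β k j) + sum tail ≡⟨ sym (∑-distrib-+ (λ j → x j * β k j) tail) ⟩
  sum (λ j → x j * β k j + tail j)   ≡⟨ sum-cong-≗ split ⟩
  sum x                              ∎
  where
  open ≡-Reasoning
  tail : Vecℤ n
  tail = λ j → if inFirst k j then 0ℤ else x j
  split : ∀ j → x j * β k j + tail j ≡ x j
  split j with inFirst k j
  ... | true  = trans (+-identityʳ _) (*-identityʳ (x j))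
  ... | false = trans (cong (λ s → s + x j) (*-zeroʳ (x j))) (+-identityˡ (x j))

sβ≗+*β : ∀ {n} k (x : Vecℤ n) → ∀ {d} → sum x ≡ d * + suc k →
  sβ (suc k) x ≗ λ j → x j + (tailSum (suc k) x - + 2 * d) * β (suc k) j
sβ≗+*β k x Σx j =
  trans unfold (cong (λ e → x j + (tailSum (suc k) x - + 2 * e) * β (suc k) j) (deg-exact k x Σx))
  where
  c = tailSum (suc k) x - + 2 * deg (suc k) x
  unfold : sβ (suc k) x j ≡ x j + c * β (suc k) j
  unfold with inFirst (suc k) j
  ... | true  = cong (_+_ (x j)) (sym (*-identityʳ c))
  ... | false = sym (trans (cong (_+_ (x j)) (*-zeroʳ c)) (+-identityʳ (x j)))

sum-+*β : ∀ {n} k → k ℕ.≤ n → (x : Vecℤ n) → ∀ {d} r → sum x ≡ d * + k →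
  sum (λ j → x j + r * β k j) ≡ (d + r) * + k
sum-+*β {n} k k≤n x {d} r Σx = begin
  sum (λ j → x j + r * b j)   ≡⟨ ∑-distrib-+ x (λ j → r * b j) ⟩
  sum x + sum (λ j → r * b j) ≡⟨ cong (_+_ (sum x)) (sym (*-distribˡ-sum r b)) ⟩
  sum x + r * sum b           ≡⟨ cong₂ (λ s t → s + r * t) Σx (sum-β n k k≤n) ⟩
  d * + k + r * + k           ≡⟨ sym (*-distribʳ-+ (+ k) d r) ⟩
  (d + r) * + k               ∎
  where
  open ≡-Reasoning
  b : Vecℤ n
  b = β k

deg-sβ : ∀ {n} k → suc k ℕ.≤ n → (x : Vecℤ n) → ∀ {d} → sum x ≡ d * + suc k →
  deg (suc k) (sβ (suc k) x) ≡ d + (tailSum (suc k) x - + 2 * d)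
deg-sβ k k<n x {d} Σx = deg-exact k (sβ (suc k) x) (trans (sum-cong-≗ (sβ≗+*β k x {d} Σx)) Σsβx)
  where
  Σsβx = sum-+*β (suc k) k<n x {d} (tailSum (suc k) x - + 2 * d) Σx

·-self-+*β : ∀ {n} k → k ℕ.≤ n → (x : Vecℤ n) (r : ℤ) →
  let y = λ j → x j + r * β k j in
  y · y ≡ x · x + (+ 2 * r) * (x · β k) + (r * r) * + k
·-self-+*β {n} k k≤n x r = begin
  sum (λ j → y j * y j)
    ≡⟨ sum-cong-≗ (λ j → expand (x j) (b j) r) ⟩
  sum (λ j → x j * x j + (+ 2 * r) * (x j * b j) + (r * r) * (b j * b j))
    ≡⟨ trans (∑-distrib-+ (λ j → x j * x j + cross j) cross²)
             (cong (λ s → s + sum cross²) (∑-distrib-+ (λ j → x j * x j) cross)) ⟩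
  x · x + sum cross + sum cross²
    ≡⟨ sym (cong₂ (λ s t → x · x + s + t) (*-distribˡ-sum (+ 2 * r) (λ j → x j * b j))
                                            (*-distribˡ-sum (r * r) (λ j → b j * b j))) ⟩
  x · x + (+ 2 * r) * (x · b) + (r * r) * (b · b)
    ≡⟨ cong (λ s → x · x + (+ 2 * r) * (x · b) + (r * r) * s) (β·β n k k≤n) ⟩
  x · x + (+ 2 * r) * (x · b) + (r * r) * + k ∎
  where
  open ≡-Reasoning
  b y cross cross² : Vecℤ n
  b = β k
  y = λ j → x j + r * b j
  cross = λ j → (+ 2 * r) * (x j * b j)
  cross² = λ j → (r * r) * (b j * b j)
  expand : ∀ a b r → (a + r * b) * (a + r * b) ≡ a * a + (+ 2 * r) * (a * b) + (r * r) * (b * b)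
  expand = solve-∀

a+b*[c-c]≡a : ∀ a b c → a + b * (c - c) ≡ a
a+b*[c-c]≡a = solve-∀

-- The degree is carried as a witness d with Σ x = d·k, so that no division occurs.
HasNormTwo : ∀ {n} → ℕ → Vecℤ n → Set
HasNormTwo k x = ∃[ d ] sum x ≡ d * + k × x · x + (+ 2 - + k) * (d * d) ≡ + 2

hasNormTwo-cong : ∀ {n k} {x y : Vecℤ n} → x ≗ y → HasNormTwo k x → HasNormTwo k y
hasNormTwo-cong {k = k} {x} {y} x≗y (d , Σx , ‖x‖) =
  d , trans (sym (sum-cong-≗ x≗y)) Σx , trans (cong (λ s → s + (+ 2 - + k) * (d * d)) y·y≡x·x) ‖x‖
  where
  y·y≡x·x : y · y ≡ x · x
  y·y≡x·x = sum-cong-≗ (λ j → sym (cong₂ _*_ (x≗y j) (x≗y j)))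

β-hasNormTwo : ∀ n k → k ℕ.≤ n → HasNormTwo k (β {n} k)
β-hasNormTwo n k k≤n =
  1ℤ , trans (sum-β n k k≤n) (sym (*-identityˡ (+ k))) ,
  trans (cong (λ s → s + (+ 2 - + k) * (1ℤ * 1ℤ)) (β·β n k k≤n)) (cancel (+ k))
  where
  cancel : ∀ K → K + (+ 2 - K) * (1ℤ * 1ℤ) ≡ + 2
  cancel = solve-∀

swapFin-hasNormTwo : ∀ {n k} (a b : Fin n) {x : Vecℤ n} →
  HasNormTwo k x → HasNormTwo k (x ∘ swapFin a b)
swapFin-hasNormTwo {k = k} a b {x} (d , Σx , ‖x‖) =
  d , trans (sum-swapFin a b x) Σx ,
  trans (cong (λ s → s + (+ 2 - + k) * (d * d)) (sum-swapFin a b (λ j → x j * x j))) ‖x‖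

reflect-hasNormTwo : ∀ {n} k → k ℕ.≤ n → (x : Vecℤ n) → ∀ {d} → sum x ≡ d * + k →
  x · x + (+ 2 - + k) * (d * d) ≡ + 2 →
  HasNormTwo k (λ j → x j + (tailSum k x - + 2 * d) * β k j)
reflect-hasNormTwo k k≤n x {d} Σx ‖x‖ = d + r , sum-+*β k k≤n x {d} r Σx , (begin
  y · y + (+ 2 - K) * ((d + r) * (d + r))
    ≡⟨ cong (λ s → s + (+ 2 - K) * ((d + r) * (d + r))) (·-self-+*β k k≤n x r) ⟩
  x · x + (+ 2 * r) * H + (r * r) * K + (+ 2 - K) * ((d + r) * (d + r))
    ≡⟨ regroup (x · x) H T d K ⟩
  (x · x + (+ 2 - K) * (d * d)) + (+ 2 * r) * ((H + T) - d * K)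
    ≡⟨ cong₂ (λ s t → s + (+ 2 * r) * (t - d * K)) ‖x‖ (trans (·β+tailSum k x) Σx) ⟩
  + 2 + (+ 2 * r) * (d * K - d * K)
    ≡⟨ a+b*[c-c]≡a (+ 2) (+ 2 * r) (d * K) ⟩
  + 2 ∎)
  where
  open ≡-Reasoning
  K = + k
  H = x · β k
  T = tailSum k x
  r = T - + 2 * d
  y = λ j → x j + r * β k j
  regroup : ∀ Q H T d K →
    Q + (+ 2 * (T - + 2 * d)) * H + ((T - + 2 * d) * (T - + 2 * d)) * K
      + (+ 2 - K) * ((d + (T - + 2 * d)) * (d + (T - + 2 * d)))
    ≡ (Q + (+ 2 - K) * (d * d)) + (+ 2 * (T - + 2 * d)) * ((H + T) - d * K)
  regroup = solve-∀

sβ-hasNormTwo : ∀ {n} k → suc k ℕ.≤ n → (x : Vecℤ n) →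
  HasNormTwo (suc k) x → HasNormTwo (suc k) (sβ (suc k) x)
sβ-hasNormTwo k k<n x (d , Σx , ‖x‖) =
  hasNormTwo-cong (sym ∘ sβ≗+*β k x {d} Σx) (reflect-hasNormTwo (suc k) k<n x {d} Σx ‖x‖)

actAll-β-hasNormTwo : ∀ {n} k → suc k ℕ.≤ n → (ws : List (Gen n)) →
  HasNormTwo (suc k) (actAll (suc k) ws (β (suc k)))
actAll-β-hasNormTwo {n} k k<n []             = β-hasNormTwo n (suc k) k<n
actAll-β-hasNormTwo     k k<n (sα i p ∷ ws)  =
  swapFin-hasNormTwo (fromℕ< (ℕ.<-trans (ℕ.n<1+n i) p)) (fromℕ< p) (actAll-β-hasNormTwo k k<n ws)
actAll-β-hasNormTwo     k k<n (sβg ∷ ws)     =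
  sβ-hasNormTwo k k<n (actAll (suc k) ws (β (suc k))) (actAll-β-hasNormTwo k k<n ws)

realRoot⇒hasNormTwo : ∀ {n} k → suc k ℕ.≤ n → {x : Vecℤ n} →
  RealRoot n (suc k) x → HasNormTwo (suc k) x
realRoot⇒hasNormTwo k k<n (ws , ws·β≗x) = hasNormTwo-cong ws·β≗x (actAll-β-hasNormTwo k k<n ws)

·-α : ∀ {n} (x : Vecℤ n) m (p : suc m ℕ.< n) →
  x · α m ≡ x (fromℕ< p) - x (fromℕ< (ℕ.<-trans (ℕ.n<1+n m) p))
·-α {n} x m p = begin
  sum (λ j → x j * (δ (suc m) j - δ m j))
    ≡⟨ sum-cong-≗ (λ j → split (x j) (δ (suc m) j) (δ m j)) ⟩
  sum (λ j → x j * δ (suc m) j + - (x j * δ m j))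
    ≡⟨ ∑-distrib-+ (λ j → x j * δ (suc m) j) (λ j → - (x j * δ m j)) ⟩
  sum (λ j → x j * δ (suc m) j) + sum (λ j → - (x j * δ m j))
    ≡⟨ cong₂ _+_ (sum-*-indicator x (suc m) p)
                 (trans (sum-neg (λ j → x j * δ m j)) (cong -_ (sum-*-indicator x m m<n))) ⟩
  x (fromℕ< p) - x (fromℕ< m<n) ∎
  where
  open ≡-Reasoning
  m<n = ℕ.<-trans (ℕ.n<1+n m) p
  δ : ℕ → Vecℤ n
  δ m j = indicator (does (toℕ j ℕ.≟ m))
  split : ∀ a b c → a * (b - c) ≡ a * b + - (a * c)
  split = solve-∀

αTerm : ∀ {n} → (Fin n → ℕ) → Fin n → Vecℤ n
αTerm {n} c i j = if suc (toℕ i) <ᵇ n then + c i * α (toℕ i) j else 0ℤ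

·-αComb : ∀ {n} (c : Fin n → ℕ) (y : Vecℤ n) → y · αComb c ≡ sum (λ i → y · αTerm c i)
·-αComb c y = begin
  sum (λ j → y j * αComb c j)
    ≡⟨ sum-cong-≗ (λ j → cong (_*_ (y j)) (sumℤ≡sum (λ i → αTerm c i j))) ⟩
  sum (λ j → y j * sum (λ i → αTerm c i j))
    ≡⟨ sum-cong-≗ (λ j → *-distribˡ-sum (y j) (λ i → αTerm c i j)) ⟩
  sum (λ j → sum (λ i → y j * αTerm c i j))
    ≡⟨ ∑-comm (λ j i → y j * αTerm c i j) ⟩
  sum (λ i → y · αTerm c i) ∎
  where open ≡-Reasoning

·-αTerm : ∀ {n} (c : Fin n → ℕ) (y : Vecℤ n) i →
  y · αTerm c i ≡ 0ℤ ⊎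
  Σ (suc (toℕ i) ℕ.< n) λ p →
    y · αTerm c i ≡ + c i * (y (fromℕ< p) - y (fromℕ< (ℕ.<-trans (ℕ.n<1+n _) p)))
·-αTerm {n} c y i with suc (toℕ i) <ᵇ n | ℕ.<ᵇ-reflects-< (suc (toℕ i)) n
... | false | _     = inj₁ (trans (sum-cong-≗ (*-zeroʳ ∘ y)) (sum-replicate-zero n))
... | true  | ofʸ p = inj₂ (p , (begin
  sum (λ j → y j * (+ c i * α (toℕ i) j)) ≡⟨ sum-cong-≗ (λ j → swap (y j) (+ c i) (α (toℕ i) j)) ⟩
  sum (λ j → + c i * (y j * α (toℕ i) j)) ≡⟨ sym (*-distribˡ-sum (+ c i) (λ j → y j * α (toℕ i) j)) ⟩
  + c i * (y · α (toℕ i))                 ≡⟨ cong (_*_ (+ c i)) (·-α y (toℕ i) p) ⟩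
  _ ∎))
  where
  open ≡-Reasoning
  swap : ∀ a b e → a * (b * e) ≡ b * (a * e)
  swap = solve-∀

sum-αComb : ∀ {n} (c : Fin n → ℕ) → sum (αComb c) ≡ 0ℤ
sum-αComb {n} c = begin
  sum (αComb c)                      ≡⟨ sum-cong-≗ (sym ∘ *-identityˡ ∘ αComb c) ⟩
  (λ _ → 1ℤ) · αComb c               ≡⟨ ·-αComb c (λ _ → 1ℤ) ⟩
  sum (λ i → (λ _ → 1ℤ) · αTerm c i) ≡⟨ sum-cong-≗ vanish ⟩
  sum {n} (λ _ → 0ℤ)                 ≡⟨ sum-replicate-zero n ⟩
  0ℤ                                 ∎
  where
  open ≡-Reasoning
  vanish : ∀ i → (λ _ → 1ℤ) · αTerm c i ≡ 0ℤ
  vanish i with ·-αTerm c (λ _ → 1ℤ) i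
  ... | inj₁ e       = e
  ... | inj₂ (_ , e) = trans e (*-zeroʳ (+ c i))

·-αComb-nonPos : ∀ {n} (c : Fin n → ℕ) (x : Vecℤ n) → IsDecreasing x → x · αComb c ≤ 0ℤ
·-αComb-nonPos c x dec =
  ≤-trans (≤-reflexive (·-αComb c x)) (sum-nonPos (λ i → x · αTerm c i) term≤0)
  where
  term≤0 : ∀ i → x · αTerm c i ≤ 0ℤ
  term≤0 i with ·-αTerm c x i
  ... | inj₁ e       = ≤-reflexive e
  ... | inj₂ (p , e) = ≤-trans (≤-reflexive e) (descent p)
    where
    descent : ∀ p → + c i * (x (fromℕ< p) - x (fromℕ< (ℕ.<-trans (ℕ.n<1+n _) p))) ≤ 0ℤ
    descent p = ≤-trans (*-monoˡ-≤-nonNeg (+ c i) (i≤j⇒i-j≤0 (dec _ _ i≤i+1)))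
                        (≤-reflexive (*-zeroʳ (+ c i)))
      where
      i≤i+1 : toℕ (fromℕ< (ℕ.<-trans (ℕ.n<1+n _) p)) ℕ.≤ toℕ (fromℕ< p)
      i≤i+1 = subst₂ ℕ._≤_ (sym (toℕ-fromℕ< _)) (sym (toℕ-fromℕ< p)) (ℕ.n≤1+n (toℕ i))

sum-positive : ∀ {n k d} {c : Fin n → ℕ} → k ℕ.≤ n → {x : Vecℤ n} →
  x ≗ (λ j → + d * β k j + αComb c j) → sum x ≡ + d * + k
sum-positive {n} {k} {d} {c} k≤n {x} x≗ = begin
  sum x                                 ≡⟨ sum-cong-≗ x≗ ⟩
  sum (λ j → + d * b j + αComb c j)     ≡⟨ ∑-distrib-+ (λ j → + d * b j) (αComb c) ⟩
  sum (λ j → + d * b j) + sum (αComb c) ≡⟨ cong₂ _+_ (sym (*-distribˡ-sum (+ d) b)) (sum-αComb c) ⟩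
  + d * sum b + 0ℤ                      ≡⟨ +-identityʳ (+ d * sum b) ⟩
  + d * sum b                           ≡⟨ cong (_*_ (+ d)) (sum-β n k k≤n) ⟩
  + d * + k                             ∎
  where
  open ≡-Reasoning
  b : Vecℤ n
  b = β k

·-self≤deg*·β : ∀ {n k d} {c : Fin n → ℕ} {x : Vecℤ n} →
  x ≗ (λ j → + d * β k j + αComb c j) → IsDecreasing x → x · x ≤ + d * (x · β k)
·-self≤deg*·β {n} {k} {d} {c} {x} x≗ dec = begin
  sum (λ j → x j * x j)                          ≡⟨ sum-cong-≗ (λ j → cong (_*_ (x j)) (x≗ j)) ⟩
  sum (λ j → x j * (+ d * b j + αComb c j))      ≡⟨ sum-cong-≗ (λ j → expand (x j) (+ d) (b j) (αComb c j)) ⟩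
  sum (λ j → + d * (x j * b j) + x j * αComb c j)
    ≡⟨ ∑-distrib-+ (λ j → + d * (x j * b j)) (λ j → x j * αComb c j) ⟩
  sum (λ j → + d * (x j * b j)) + x · αComb c
    ≡⟨ cong (λ s → s + x · αComb c) (sym (*-distribˡ-sum (+ d) (λ j → x j * b j))) ⟩
  + d * (x · b) + x · αComb c                    ≤⟨ +-monoʳ-≤ (+ d * (x · b)) (·-αComb-nonPos c x dec) ⟩
  + d * (x · b) + 0ℤ                             ≡⟨ +-identityʳ (+ d * (x · b)) ⟩
  + d * (x · b)                                  ∎
  where
  open ≤-Reasoning
  b : Vecℤ n
  b = β k
  expand : ∀ a D e f → a * (D * e + f) ≡ D * (a * e) + a * f
  expand = solve-∀

hasNormTwo-at : ∀ {n k} {x : Vecℤ n} {d} → HasNormTwo (suc k) x → sum x ≡ d * + suc k →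
  x · x + (+ 2 - + suc k) * (d * d) ≡ + 2
hasNormTwo-at {k = k} {d = d} (d₀ , Σx₀ , ‖x‖) Σx
  with refl ← *-cancelʳ-≡ d₀ d (+ suc k) (trans (sym Σx₀) Σx) = ‖x‖

reflection-shift-negative : ∀ {Q H T D K : ℤ} → 0ℤ ≤ D → Q ≤ D * H → H + T ≡ D * K →
  Q + (+ 2 - K) * (D * D) ≡ + 2 → T - + 2 * D < 0ℤ
reflection-shift-negative {Q} {H} {T} {D} {K} 0≤D Q≤DH H+T≡DK norm =
  *-cancelˡ-<-nonNeg D {{nonNegative 0≤D}} (begin-strict
    D * (T - + 2 * D)                   ≡⟨ rearrange H T D K ⟩
    - bound + D * ((H + T) - D * K)     ≡⟨ cong (λ s → - bound + D * (s - D * K)) H+T≡DK ⟩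
    - bound + D * (D * K - D * K)       ≡⟨ a+b*[c-c]≡a (- bound) D (D * K) ⟩
    - bound                             ≤⟨ neg-mono-≤ (+-monoˡ-≤ ((+ 2 - K) * (D * D)) Q≤DH) ⟩
    - (Q + (+ 2 - K) * (D * D))         ≡⟨ cong -_ norm ⟩
    - + 2                               <⟨ -<+ ⟩
    0ℤ                                  ≡⟨ sym (*-zeroʳ D) ⟩
    D * 0ℤ                              ∎)
  where
  open ≤-Reasoning
  bound = D * H + (+ 2 - K) * (D * D)
  rearrange : ∀ H T D K → D * (T - + 2 * D) ≡ - (D * H + (+ 2 - K) * (D * D)) + D * ((H + T) - D * K)
  rearrange = solve-∀

corollary2p5 : (n k : ℕ) → 1 ℕ.≤ k → k ℕ.< n → (x : Vecℤ n) →
    RealRoot n k x → Positive n k x → IsDecreasing x →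
    deg k (sβ k x) <ℤ deg k x
corollary2p5 n (suc k) _ k<n x root (d , c , x≗) dec = begin-strict
  deg (suc k) (sβ (suc k) x) ≡⟨ deg-sβ k k≤n x {D} Σx ⟩
  D + (T - + 2 * D)          <⟨ +-monoʳ-< D shift<0 ⟩
  D + 0ℤ                     ≡⟨ +-identityʳ D ⟩
  D                          ≡⟨ sym (deg-exact k x Σx) ⟩
  deg (suc k) x              ∎
  where
  open ≤-Reasoning
  D = + d
  T = tailSum (suc k) x
  k≤n = ℕ.<⇒≤ k<n
  Σx : sum x ≡ D * + suc k
  Σx = sum-positive {d = d} {c} k≤n x≗
  ‖x‖²-bound : x · x ≤ D * (x · β (suc k))
  ‖x‖²-bound = ·-self≤deg*·β {k = suc k} {d} {c} x≗ dec
  ‖x‖² : x · x + (+ 2 - + suc k) * (D * D) ≡ + 2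
  ‖x‖² = hasNormTwo-at {k = k} {x} {D} (realRoot⇒hasNormTwo k k≤n root) Σx
  shift<0 : T - + 2 * D < 0ℤ
  shift<0 = reflection-shift-negative {D = D} {+ suc k} (+≤+ z≤n) ‖x‖²-bound
              (trans (·β+tailSum (suc k) x) Σx) ‖x‖²
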